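{- For any $\mathbf{x},\mathbf{y},\mathbf{z}\in\mathbb{R}^4$, \begin{align*} \Psi_-(\mathbf{x},\mathbf{y},\mathbf{z})^-&=\det(\mathbf{x}^-,\mathbf{y}^-,\mathbf{z}^+)\mathbf{y}^--\det(\mathbf{x}^-,\mathbf{y}^-,\mathbf{z}^-)\mathbf{y}^+,\\ \Psi_+(\mathbf{x},\mathbf{y},\mathbf{z})^+&=\det(\mathbf{x}^+,\mathbf{y}^+,\mathbf{z}^+)\mathbf{y}^--\det(\mathbf{x}^+,\mathbf{y}^+,\mathbf{z}^-)\mathbf{y}^+. \end{align*}
   Context: For $\mathbf{x}=(x_0,\dots,x_3)\in\mathbb{R}^4$: $\mathbf{x}^-=(x_0,x_1,x_2)$, $\mathbf{x}^+=(x_1,x_2,x_3)$. For $P=(p_0,p_1)\in\mathbb{R}^2$, $P^-=p_0$, $P^+=p_1$. $\det(\mathbf{u}_1,\mathbf{u}_2,\mathbf{u}_3)$ is the determinant of the matrix with rows $\mathbf{u}_1,\mathbf{u}_2,\mathbf{u}_3\in\mathbb{R}^3$. $C(\mathbf{x},\mathbf{y})=(\det(\mathbf{x}^-,\mathbf{x}^+,\mathbf{y}^-),\det(\mathbf{x}^-,\mathbf{x}^+,\mathbf{y}^+))$; $E(\mathbf{w},\mathbf{x},\mathbf{y})=\big(\det(\mathbf{w}^-,\mathbf{x}^+,\mathbf{y}^-)-\det(\mathbf{w}^+,\mathbf{x}^-,\mathbf{y}^-),\ \det(\mathbf{w}^-,\mathbf{x}^+,\mathbf{y}^+)-\det(\mathbf{w}^+,\mathbf{x}^-,\mathbf{y}^+)\big)$;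 for $\epsilon\in\{ -,+\}$, $\Psi_\epsilon(\mathbf{x},\mathbf{y},\mathbf{z})=C(\mathbf{y},\mathbf{z})^\epsilon\mathbf{x}+E(\mathbf{y},\mathbf{z},\mathbf{x})^\epsilon\mathbf{y}-C(\mathbf{y},\mathbf{x})^\epsilon\mathbf{z}\in\mathbb{R}^4$. -}

module Defs where

open import Level using (_⊔_)
open import Data.Fin using (Fin; zero; suc; inject₁)
open import Data.Product using (_×_; _,_; proj₁; proj₂)
open import Algebra.Bundles using (CommutativeRing)

-- The paper works over ℝ; the identity is a polynomial identity with
-- integer coefficients, so we state it over an arbitrary commutative ring.

data Sign : Set where
  minus plus : Sign

module Geometry {c ℓ} (R : CommutativeRing c ℓ) where
  open CommutativeRing R hiding (zero)

  Vec4 : Set c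
  Vec4 = Fin 4 → Carrier

  Vec3 : Set c
  Vec3 = Fin 3 → Carrier

  _≋_ : ∀ {n} → (Fin n → Carrier) → (Fin n → Carrier) → Set ℓ
  u ≋ v = ∀ i → u i ≈ v i

  infixl 6 _⊕_ _⊖_
  infixl 7 _·_

  _⊕_ : ∀ {n} → (Fin n → Carrier) → (Fin n → Carrier) → (Fin n → Carrier)
  (u ⊕ v) i = u i + v i

  _⊖_ : ∀ {n} → (Fin n → Carrier) → (Fin n → Carrier) → (Fin n → Carrier)
  (u ⊖ v) i = u i - v i

  _·_ : ∀ {n} → Carrier → (Fin n → Carrier) → (Fin n → Carrier)
  (a · u) i = a * u i

  _⁻ : Vec4 → Vec3
  (x ⁻) i = x (inject₁ i)

  _⁺ : Vec4 → Vec3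
  (x ⁺) i = x (suc i)

  sel : Sign → Carrier × Carrier → Carrier
  sel minus P = proj₁ P
  sel plus  P = proj₂ P

  det : Vec3 → Vec3 → Vec3 → Carrier
  det u v w =
      u 0F * (v 1F * w 2F - v 2F * w 1F)
    - u 1F * (v 0F * w 2F - v 2F * w 0F)
    + u 2F * (v 0F * w 1F - v 1F * w 0F)
    where
      0F 1F 2F : Fin 3
      0F = zero
      1F = suc zero
      2F = suc (suc zero)

  C : Vec4 → Vec4 → Carrier × Carrier
  C x y = det (x ⁻) (x ⁺) (y ⁻) , det (x ⁻) (x ⁺) (y ⁺)

  E : Vec4 → Vec4 → Vec4 → Carrier × Carrier
  E w x y = (det (w ⁻) (x ⁺) (y ⁻) - det (w ⁺) (x ⁻) (y ⁻))
          , (det (w ⁻) (x ⁺) (y ⁺) - det (w ⁺) (x ⁻) (y ⁺))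

  Ψ : Sign → Vec4 → Vec4 → Vec4 → Vec4
  Ψ ε x y z = sel ε (C y z) · x ⊕ sel ε (E y z x) · y ⊖ sel ε (C y x) · z

{-# OPTIONS --safe #-}
-- For Ψ_ε put a = x^ε, b = y⁻, c = y⁺ and d = z^ε. Up to the cyclic
-- permutation det(b,c,a) = det(a,b,c), the outer terms C(y,z)x − C(y,x)z of Ψ form one
-- side of Cramer's relation det(b,c,d)a − det(a,b,c)d = det(a,c,d)b − det(a,b,d)c among
-- four vectors of a three-dimensional space. Trading it for the other side, one of the
-- two new terms is cancelled by the middle term, whose coefficient E(y,z,x) is
-- det(a,y⁻,z⁺) − det(a,y⁺,z⁻) up to cyclic permutations.
module Submission where

open import Defs
open import Level using (Level)
open import Data.Product using (_×_; _,_)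
open import Data.Fin using (Fin; zero; suc; #_)
open import Data.Vec.Base using (Vec; []; _∷_; _++_)
open import Data.Maybe.Base using (Maybe; map)
open import Function.Base using (_∘_)
open import Data.Nat.Base as ℕ using (zero; suc)
open import Data.Nat.Properties using (+-suc)
open import Data.Integer.Base as ℤ using (ℤ; +_; -[1+_]; sign; ∣_∣; _◃_)
open import Data.Integer.Properties using ([1+m]⊖[1+n]≡m⊖n; _≟_)
import Data.Sign.Base as Sgn
open import Algebra.Bundles using (CommutativeRing)
open import Algebra.Solver.Ring.AlmostCommutativeRing
  using (fromCommutativeRing; _-Raw-AlmostCommutative⟶_)
open import Relation.Binary.Consequences using (dec⇒weaklyDec)
import Relation.Binary.PropositionalEquality.Core as ≡

-- The ring solver recognises cancelling monomials only through a test for equality of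
-- coefficients, which an arbitrary ring lacks; so coefficients are taken in ℤ instead,
-- interpreted through the canonical map ℤ → R.
module IntegerCoefficients {r ℓ} (R : CommutativeRing r ℓ) where
  open CommutativeRing R
  open import Algebra.Properties.Ring ring
  open import Algebra.Properties.Semiring.Mult semiring
    using (×-homo-+; ×1-homo-*) renaming (_×_ to _×′_)
  open import Algebra.Properties.CommutativeSemigroup +-commutativeSemigroup
    using (interchange)
  open import Relation.Binary.Reasoning.Setoid setoid

  signed : Sgn.Sign → Carrier → Carrier
  signed Sgn.+ x = x
  signed Sgn.- x = - x

  signed-cong : ∀ s {x y} → x ≈ y → signed s x ≈ signed s y
  signed-cong Sgn.+ x≈y = x≈y
  signed-cong Sgn.- x≈y = -‿cong x≈y

  signed-* : ∀ s t x y → signed (s Sgn.* t) (x * y) ≈ signed s x * signed t y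
  signed-* Sgn.+ Sgn.+ x y = refl
  signed-* Sgn.+ Sgn.- x y = -‿distribʳ-* x y
  signed-* Sgn.- Sgn.+ x y = -‿distribˡ-* x y
  signed-* Sgn.- Sgn.- x y = begin
    x * y         ≈⟨ -‿involutive (x * y) ⟨
    - - (x * y)   ≈⟨ -‿cong (-‿distribˡ-* x y) ⟩
    - (- x * y)   ≈⟨ -‿distribʳ-* (- x) y ⟩
    - x * - y     ∎

  ⟦_⟧ℤ : ℤ → Carrier
  ⟦ i ⟧ℤ = signed (sign i) (∣ i ∣ ×′ 1#)

  ◃-homo : ∀ s n → ⟦ s ◃ n ⟧ℤ ≈ signed s (n ×′ 1#)
  ◃-homo Sgn.+ zero    = refl
  ◃-homo Sgn.- zero    = sym -0#≈0#
  ◃-homo Sgn.+ (suc n) = refl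
  ◃-homo Sgn.- (suc n) = refl

  [1+x]-[1+y]≈x-y : ∀ x y → (1# + x) - (1# + y) ≈ x - y
  [1+x]-[1+y]≈x-y x y = begin
    (1# + x) - (1# + y)       ≈⟨ +-congˡ (-‿+-comm 1# y) ⟨
    (1# + x) + (- 1# + - y)   ≈⟨ interchange 1# x (- 1#) (- y) ⟩
    (1# - 1#) + (x - y)       ≈⟨ +-congʳ (-‿inverseʳ 1#) ⟩
    0# + (x - y)              ≈⟨ +-identityˡ (x - y) ⟩
    x - y                     ∎

  ⊖-homo : ∀ m n → ⟦ m ℤ.⊖ n ⟧ℤ ≈ m ×′ 1# - n ×′ 1#
  ⊖-homo m       zero    = sym (trans (+-congˡ -0#≈0#) (+-identityʳ (m ×′ 1#)))
  ⊖-homo zero    (suc n) = sym (+-identityˡ _)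
  ⊖-homo (suc m) (suc n) = begin
    ⟦ suc m ℤ.⊖ suc n ⟧ℤ        ≡⟨ ≡.cong ⟦_⟧ℤ ([1+m]⊖[1+n]≡m⊖n m n) ⟩
    ⟦ m ℤ.⊖ n ⟧ℤ                ≈⟨ ⊖-homo m n ⟩
    m ×′ 1# - n ×′ 1#           ≈⟨ [1+x]-[1+y]≈x-y (m ×′ 1#) (n ×′ 1#) ⟨
    suc m ×′ 1# - suc n ×′ 1#   ∎

  +-homo : ∀ i j → ⟦ i ℤ.+ j ⟧ℤ ≈ ⟦ i ⟧ℤ + ⟦ j ⟧ℤ
  +-homo (+ m)    (+ n)    = ×-homo-+ 1# m n
  +-homo (+ m)    -[1+ n ] = ⊖-homo m (suc n)
  +-homo -[1+ m ] (+ n)    = trans (⊖-homo n (suc m)) (+-comm _ _)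
  +-homo -[1+ m ] -[1+ n ] = begin
    - (suc (suc (m ℕ.+ n)) ×′ 1#)       ≡⟨ ≡.cong (λ k → - (suc k ×′ 1#)) (+-suc m n) ⟨
    - ((suc m ℕ.+ suc n) ×′ 1#)         ≈⟨ -‿cong (×-homo-+ 1# (suc m) (suc n)) ⟩
    - (suc m ×′ 1# + suc n ×′ 1#)       ≈⟨ -‿+-comm _ _ ⟨
    - (suc m ×′ 1#) + - (suc n ×′ 1#)   ∎

  *-homo : ∀ i j → ⟦ i ℤ.* j ⟧ℤ ≈ ⟦ i ⟧ℤ * ⟦ j ⟧ℤ
  *-homo i j = begin
    ⟦ s ◃ ∣ i ∣ ℕ.* ∣ j ∣ ⟧ℤ                 ≈⟨ ◃-homo s (∣ i ∣ ℕ.* ∣ j ∣) ⟩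
    signed s ((∣ i ∣ ℕ.* ∣ j ∣) ×′ 1#)       ≈⟨ signed-cong s (×1-homo-* ∣ i ∣ ∣ j ∣) ⟩
    signed s (∣ i ∣ ×′ 1# * ∣ j ∣ ×′ 1#)     ≈⟨ signed-* (sign i) (sign j) _ _ ⟩
    ⟦ i ⟧ℤ * ⟦ j ⟧ℤ                         ∎
    where
      s : Sgn.Sign
      s = sign i Sgn.* sign j

  -‿homo : ∀ i → ⟦ ℤ.- i ⟧ℤ ≈ - ⟦ i ⟧ℤ
  -‿homo (+ zero)  = sym -0#≈0#
  -‿homo (+ suc n) = refl
  -‿homo -[1+ n ]  = sym (-‿involutive _)

  ℤ⟶R : ℤ.+-*-rawRing -Raw-AlmostCommutative⟶ fromCommutativeRing R
  ℤ⟶R = record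
    { ⟦_⟧    = ⟦_⟧ℤ
    ; +-homo = +-homo
    ; *-homo = *-homo
    ; -‿homo = -‿homo
    ; 0-homo = refl
    ; 1-homo = +-identityʳ 1#
    }

  equal-coefficients? : ∀ i j → Maybe (⟦ i ⟧ℤ ≈ ⟦ j ⟧ℤ)
  equal-coefficients? i j = map (reflexive ∘ ≡.cong ⟦_⟧ℤ) (dec⇒weaklyDec _≟_ i j)

  open import Algebra.Solver.Ring ℤ.+-*-rawRing (fromCommutativeRing R) ℤ⟶R equal-coefficients?
    public

module Determinant {r ℓ} (R : CommutativeRing r ℓ) where
  open CommutativeRing R using (Carrier; _≈_; refl)
  open Geometry R using (Vec3; det; _≋_; _·_; _⊖_)
  open IntegerCoefficients R using (Polynomial; var; _:+_; _:-_; _:*_; prove)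

  0F 1F 2F : Fin 3
  0F = zero
  1F = suc zero
  2F = suc (suc zero)

  ⟨_,_,_⟩ : ∀ {a} {A : Set a} → A → A → A → Fin 3 → A
  ⟨ u₀ , u₁ , u₂ ⟩ zero             = u₀
  ⟨ u₀ , u₁ , u₂ ⟩ (suc zero)       = u₁
  ⟨ u₀ , u₁ , u₂ ⟩ (suc (suc zero)) = u₂

  -- The denotation of detₚ unfolds definitionally to det, so prove applies to goals about det.
  detₚ : ∀ {n} (u v w : Fin 3 → Polynomial n) → Polynomial n
  detₚ u v w =
      u 0F :* (v 1F :* w 2F :- v 2F :* w 1F)
    :- u 1F :* (v 0F :* w 2F :- v 2F :* w 0F)
    :+ u 2F :* (v 0F :* w 1F :- v 1F :* w 0F)

  coordinates : Vec3 → Vec Carrier 3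
  coordinates u = u 0F ∷ u 1F ∷ u 2F ∷ []

  det-cyclic : ∀ u v w → det u v w ≈ det v w u
  det-cyclic u v w =
    prove (coordinates u ++ coordinates v ++ coordinates w) (detₚ U V W) (detₚ V W U) refl
    where
      U V W : Fin 3 → Polynomial 9
      U = ⟨ var (# 0) , var (# 1) , var (# 2) ⟩
      V = ⟨ var (# 3) , var (# 4) , var (# 5) ⟩
      W = ⟨ var (# 6) , var (# 7) , var (# 8) ⟩

  cramer : ∀ a b c d → (det b c d · a ⊖ det a b c · d) ≋ (det a c d · b ⊖ det a b d · c)
  cramer a b c d = component
    where
      ρ : Vec Carrier 12
      ρ = coordinates a ++ coordinates b ++ coordinates c ++ coordinates d

      A B C D : Fin 3 → Polynomial 12
      A = ⟨ var (# 0) , var (# 1)  , var (# 2)  ⟩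
      B = ⟨ var (# 3) , var (# 4)  , var (# 5)  ⟩
      C = ⟨ var (# 6) , var (# 7)  , var (# 8)  ⟩
      D = ⟨ var (# 9) , var (# 10) , var (# 11) ⟩

      lhs rhs : Fin 3 → Polynomial 12
      lhs i = detₚ B C D :* A i :- detₚ A B C :* D i
      rhs i = detₚ A C D :* B i :- detₚ A B D :* C i

      component : (det b c d · a ⊖ det a b c · d) ≋ (det a c d · b ⊖ det a b d · c)
      component zero             = prove ρ (lhs 0F) (rhs 0F) refl
      component (suc zero)       = prove ρ (lhs 1F) (rhs 1F) refl
      component (suc (suc zero)) = prove ρ (lhs 2F) (rhs 2F) refl

module Restrictions {r ℓ} (R : CommutativeRing r ℓ) where
  open CommutativeRing R
  open Geometry R
  open Determinant R using (det-cyclic; cramer)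
  open IntegerCoefficients R using (_:+_; _:-_; _:*_; _:=_; solve)
  open import Relation.Binary.Reasoning.Setoid setoid

  [x+y]-z≈[x-z]+y : ∀ x y z → (x + y) - z ≈ (x - z) + y
  [x+y]-z≈[x-z]+y = solve 3 (λ x y z → (x :+ y) :- z := (x :- z) :+ y) refl

  cramer-Ψ : ∀ a b c d t β i →
    (det b c d * a i + t * β) - det b c a * d i ≈ (det a c d * b i - det a b d * c i) + t * β
  cramer-Ψ a b c d t β i = begin
    (det b c d * a i + t * β) - det b c a * d i
      ≈⟨ [x+y]-z≈[x-z]+y _ _ _ ⟩
    (det b c d * a i - det b c a * d i) + t * β
      ≈⟨ +-congʳ (+-congˡ (-‿cong (*-congʳ (det-cyclic a b c)))) ⟨
    (det b c d * a i - det a b c * d i) + t * β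
      ≈⟨ +-congʳ (cramer a b c d i) ⟩
    (det a c d * b i - det a b d * c i) + t * β
      ∎

  E-cyclic : ∀ a b c d e → det b e a - det c d a ≈ det a b e - det a c d
  E-cyclic a b c d e = +-cong (sym (det-cyclic a b e)) (-‿cong (sym (det-cyclic a c d)))

  Ψ-minus-⁻ : ∀ x y z →
    ((Ψ minus x y z) ⁻) ≋ (det (x ⁻) (y ⁻) (z ⁺) · (y ⁻) ⊖ det (x ⁻) (y ⁻) (z ⁻) · (y ⁺))
  Ψ-minus-⁻ x y z i = begin
    (det b c d * a i + (det b e a - det c d a) * b i) - det b c a * d i
      ≈⟨ cramer-Ψ a b c d _ _ i ⟩
    (det a c d * b i - det a b d * c i) + (det b e a - det c d a) * b i
      ≈⟨ +-congˡ (*-congʳ (E-cyclic a b c d e)) ⟩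
    (det a c d * b i - det a b d * c i) + (det a b e - det a c d) * b i
      ≈⟨ solve 5 (λ p q r β γ → (p :* β :- q :* γ) :+ (r :- p) :* β := r :* β :- q :* γ) refl
               (det a c d) (det a b d) (det a b e) (b i) (c i) ⟩
    det a b e * b i - det a b d * c i
      ∎
    where
      a b c d e : Vec3
      a = x ⁻; b = y ⁻; c = y ⁺; d = z ⁻; e = z ⁺

  Ψ-plus-⁺ : ∀ x y z →
    ((Ψ plus x y z) ⁺) ≋ (det (x ⁺) (y ⁺) (z ⁺) · (y ⁻) ⊖ det (x ⁺) (y ⁺) (z ⁻) · (y ⁺))
  Ψ-plus-⁺ x y z i = begin
    (det b c e * a i + (det b e a - det c d a) * c i) - det b c a * e i
      ≈⟨ cramer-Ψ a b c e _ _ i ⟩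
    (det a c e * b i - det a b e * c i) + (det b e a - det c d a) * c i
      ≈⟨ +-congˡ (*-congʳ (E-cyclic a b c d e)) ⟩
    (det a c e * b i - det a b e * c i) + (det a b e - det a c d) * c i
      ≈⟨ solve 5 (λ p q r β γ → (p :* β :- q :* γ) :+ (q :- r) :* γ := p :* β :- r :* γ) refl
               (det a c e) (det a b e) (det a c d) (b i) (c i) ⟩
    det a c e * b i - det a c d * c i
      ∎
    where
      a b c d e : Vec3
      a = x ⁺; b = y ⁻; c = y ⁺; d = z ⁻; e = z ⁺

lemma4p1 : ∀ {c ℓ : Level} (R : CommutativeRing c ℓ) →
    let open CommutativeRing R using (Carrier)
        open Geometry R
    in ∀ (x y z : Vec4) →
         (((Ψ minus x y z) ⁻) ≋ (det (x ⁻) (y ⁻) (z ⁺) · (y ⁻) ⊖ det (x ⁻) (y ⁻) (z ⁻) · (y ⁺)))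
       × (((Ψ plus x y z) ⁺) ≋ (det (x ⁺) (y ⁺) (z ⁺) · (y ⁻) ⊖ det (x ⁺) (y ⁺) (z ⁻) · (y ⁺)))
lemma4p1 R x y z = Ψ-minus-⁻ x y z , Ψ-plus-⁺ x y z
  where open Restrictions R
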